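{- Let $G$ be a graph and $M$ a modulator of $G$. Let $C$ be a connected component of $G-M$ that is triangle-free, and suppose some vertex $v\in M$ forms a triangle with an edge $uw$ of $C$ (i.e., $v$ is adjacent to both $u$ and $w$). Then (i) $v$ is adjacent to every vertex of $C$, and (ii) $C$ is a complete bipartite graph.
   Context: All graphs are finite, simple and undirected. A paw is the four-vertex graph consisting of a triangle together with one additional vertex adjacent to exactly one vertex of the triangle. A set $M\subseteq V(G)$ is a modulator of $G$ if every vertex set $F\subseteq V(G)$ inducing a paw in $G$ satisfies $|F\cap M|\ge 2$. $G-M$ denotes the subgraph induced by $V(G)\setminus M$. -}

module Defs where

open import Data.Nat using (ℕ; _≥_)
open import Data.Bool using (Bool; true; false)
open import Data.Fin using (Fin)
open import Data.Fin.Subset using (Subset; _∈_; _∉_)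
open import Data.Fin.Subset.Properties using (_∈?_)
open import Data.List using (List; []; _∷_; filter; length)
open import Data.Product using (_×_; Σ; ∃; ∃-syntax; _,_)
open import Relation.Binary.PropositionalEquality using (_≡_; _≢_)
open import Relation.Nullary using (¬_)
open import Function.Bundles using (_⇔_)

record Graph (n : ℕ) : Set where
  field
    adj    : Fin n → Fin n → Bool
    sym    : ∀ x y → adj x y ≡ adj y x
    irrefl : ∀ x → adj x x ≡ false
open Graph public

module _ {n : ℕ} (G : Graph n) where

  Adj : Fin n → Fin n → Set
  Adj x y = adj G x y ≡ true

  -- (a,b,c,d) induces a paw: triangle a b c, and d adjacent to a only.
  -- (The four vertices are then automatically distinct; every induced paw
  -- arises this way for a suitable labelling.)
  IsPaw : Fin n → Fin n → Fin n → Fin n → Set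
  IsPaw a b c d =
    Adj a b × Adj b c × Adj a c × Adj d a × ¬ Adj d b × ¬ Adj d c

  countIn : Subset n → List (Fin n) → ℕ
  countIn M xs = length (filter (λ x → x ∈? M) xs)

  IsModulator : Subset n → Set
  IsModulator M = ∀ a b c d → IsPaw a b c d →
    countIn M (a ∷ b ∷ c ∷ d ∷ []) ≥ 2

  data WalkIn (C : Subset n) : Fin n → Fin n → Set where
    here : ∀ {x} → x ∈ C → WalkIn C x x
    step : ∀ {x y z} → x ∈ C → Adj x y → WalkIn C y z → WalkIn C x z

  -- C is a connected component of G - M: nonempty subset of V∖M, connected
  -- in G[C], and maximal (closed under adjacency within G - M).
  IsComponentMinus : Subset n → Subset n → Set
  IsComponentMinus M C =
    (∃[ x ] x ∈ C)
    × (∀ x → x ∈ C → x ∉ M)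
    × (∀ x y → x ∈ C → y ∈ C → WalkIn C x y)
    × (∀ x y → x ∈ C → y ∉ M → Adj x y → y ∈ C)

  TriangleFreeIn : Subset n → Set
  TriangleFreeIn C = ∀ x y z → x ∈ C → y ∈ C → z ∈ C →
    ¬ (Adj x y × Adj y z × Adj x z)

  CompleteBipartiteIn : Subset n → Set
  CompleteBipartiteIn C = Σ (Fin n → Bool) λ side →
    ∀ x y → x ∈ C → y ∈ C → (Adj x y ⇔ (side x ≢ side y))

-- Since M is a modulator, no induced paw has exactly one vertex in M. If v ∈ M
-- sees both ends of an edge xy of C and z is a C-neighbour of x with v ≁ z, then
-- x v y z is an induced paw (z ≁ y as C is triangle-free) meeting M only in v;
-- so "v sees both ends of some C-edge at x" spreads along walks in C, and v sees
-- all of C. Then an edge ab of C and a vertex z of C adjacent to neither end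
-- would give the paw v a b z, so every edge of C dominates C. For a
-- triangle-free graph with an edge uw this forces the complete bipartition of C
-- into the neighbours and the non-neighbours of u (the latter all see w).
module Submission where

open import Defs
open import Data.Nat using (ℕ; suc; _≤_; s≤s)
open import Data.Bool using (true)
open import Data.Bool.Properties using (_≟_)
open import Data.Fin using (Fin)
open import Data.Fin.Subset using (Subset; _∈_; _∉_)
open import Data.Fin.Subset.Properties using (_∈?_)
open import Data.List using ([]; _∷_; length)
open import Data.List.Properties using (filter-accept; filter-reject)
open import Data.Product using (_×_; _,_; Σ-syntax)
open import Data.Empty using (⊥; ⊥-elim)
open import Relation.Nullary using (¬_; Dec; yes; no; does)
open import Relation.Binary.PropositionalEquality
  using (_≡_; refl; cong; trans) renaming (sym to ≡-sym)
open import Function.Bundles using (mk⇔)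

module _ {n : ℕ} (G : Graph n) where

  Adj? : ∀ x y → Dec (Adj G x y)
  Adj? x y = adj G x y ≟ true

  Adj-sym : ∀ {x y} → Adj G x y → Adj G y x
  Adj-sym {x} {y} = trans (≡-sym (Graph.sym G x y))

  ¬Adj-sym : ∀ {x y} → ¬ Adj G x y → ¬ Adj G y x
  ¬Adj-sym ¬xy yx = ¬xy (Adj-sym yx)

  WalkIn-start : ∀ {C a b} → WalkIn G C a b → a ∈ C
  WalkIn-start (here a∈C)     = a∈C
  WalkIn-start (step a∈C _ _) = a∈C

  WalkIn-transport : ∀ {C} (P : Fin n → Set) →
    (∀ {x y} → x ∈ C → y ∈ C → Adj G x y → P x → P y) →
    ∀ {a b} → WalkIn G C a b → P a → P b
  WalkIn-transport P step-P (here _)           Pa = Pa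
  WalkIn-transport P step-P (step a∈C ay walk) Pa =
    WalkIn-transport P step-P walk (step-P a∈C (WalkIn-start walk) ay Pa)

  EdgesDominateIn : Subset n → Set
  EdgesDominateIn C = ∀ {a b z} → a ∈ C → b ∈ C → z ∈ C →
    Adj G a b → ¬ Adj G z a → ¬ Adj G z b → ⊥

  module _ {C : Subset n} (triangle-free : TriangleFreeIn G C)
           (dominate : EdgesDominateIn C)
           {u w : Fin n} (u∈C : u ∈ C) (w∈C : w ∈ C) (uw : Adj G u w) where

    Adj-w-of-¬Adj-u : ∀ {z} → z ∈ C → ¬ Adj G u z → Adj G w z
    Adj-w-of-¬Adj-u {z} z∈C ¬uz with Adj? w z
    ... | yes wz = wz
    ... | no ¬wz = ⊥-elim (dominate u∈C w∈C z∈C uw (¬Adj-sym ¬uz) (¬Adj-sym ¬wz))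

    Adj⇒sides-differ : ∀ {x y} → x ∈ C → y ∈ C → Adj G x y →
      does (Adj? u x) ≡ does (Adj? u y) → ⊥
    Adj⇒sides-differ {x} {y} x∈C y∈C xy same with Adj? u x | Adj? u y
    ... | yes ux | yes uy = triangle-free u x y u∈C x∈C y∈C (ux , xy , uy)
    ... | no ¬ux | no ¬uy = triangle-free w x y w∈C x∈C y∈C
      (Adj-w-of-¬Adj-u x∈C ¬ux , xy , Adj-w-of-¬Adj-u y∈C ¬uy)
    ... | yes _  | no _   with () ← same
    ... | no _   | yes _  with () ← same

    sides-differ⇒Adj : ∀ {x y} → x ∈ C → y ∈ C →
      (does (Adj? u x) ≡ does (Adj? u y) → ⊥) → Adj G x y
    sides-differ⇒Adj {x} {y} x∈C y∈C differ with Adj? x y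
    ... | yes xy = xy
    ... | no ¬xy with Adj? u x | Adj? u y
    ...   | yes _  | yes _  = ⊥-elim (differ refl)
    ...   | no _   | no _   = ⊥-elim (differ refl)
    ...   | yes ux | no ¬uy = ⊥-elim (dominate u∈C x∈C y∈C ux (¬Adj-sym ¬uy) (¬Adj-sym ¬xy))
    ...   | no ¬ux | yes uy = ⊥-elim (dominate u∈C y∈C x∈C uy (¬Adj-sym ¬ux) ¬xy)

    completeBipartite-of-edgesDominate : CompleteBipartiteIn G C
    completeBipartite-of-edgesDominate = (λ x → does (Adj? u x)) , λ x y x∈C y∈C →
      mk⇔ (Adj⇒sides-differ x∈C y∈C) (sides-differ⇒Adj x∈C y∈C)

module _ {n : ℕ} (G : Graph n) {M : Subset n} (modulator : IsModulator G M) where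

  private
    count-∈ : ∀ {a} xs → a ∈ M → countIn G M (a ∷ xs) ≡ suc (countIn G M xs)
    count-∈ xs a∈M = cong length (filter-accept (_∈? M) a∈M)

    count-∉ : ∀ {a} xs → a ∉ M → countIn G M (a ∷ xs) ≡ countIn G M xs
    count-∉ xs a∉M = cong length (filter-reject (_∈? M) a∉M)

    ¬2≤1 : ∀ {k} → k ≡ 1 → ¬ (2 ≤ k)
    ¬2≤1 refl (s≤s ())

  ¬Paw-centre-only-in-M : ∀ {a b c d} → a ∈ M → b ∉ M → c ∉ M → d ∉ M →
    ¬ IsPaw G a b c d
  ¬Paw-centre-only-in-M a∈M b∉M c∉M d∉M paw = ¬2≤1 count (modulator _ _ _ _ paw)
    where
    count = trans (count-∈ _ a∈M)
      (cong suc (trans (count-∉ _ b∉M) (trans (count-∉ _ c∉M) (count-∉ [] d∉M))))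

  ¬Paw-triangle-vertex-only-in-M : ∀ {a b c d} → a ∉ M → b ∈ M → c ∉ M → d ∉ M →
    ¬ IsPaw G a b c d
  ¬Paw-triangle-vertex-only-in-M a∉M b∈M c∉M d∉M paw = ¬2≤1 count (modulator _ _ _ _ paw)
    where
    count = trans (count-∉ _ a∉M)
      (trans (count-∈ _ b∈M) (cong suc (trans (count-∉ _ c∉M) (count-∉ [] d∉M))))

  module ApexInM {C : Subset n} (C∩M≡∅ : ∀ x → x ∈ C → x ∉ M)
           (triangle-free : TriangleFreeIn G C) {v : Fin n} (v∈M : v ∈ M) where

    SeesEdgeAt : Fin n → Set
    SeesEdgeAt x = Σ[ y ∈ Fin n ] y ∈ C × Adj G x y × Adj G v x × Adj G v y

    SeesEdgeAt-step : ∀ {x z} → x ∈ C → z ∈ C → Adj G x z →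
      SeesEdgeAt x → SeesEdgeAt z
    SeesEdgeAt-step {x} {z} x∈C z∈C xz (y , y∈C , xy , vx , vy) with Adj? G v z
    ... | yes vz = x , x∈C , Adj-sym G xz , vz , vx
    ... | no ¬vz = ⊥-elim (¬Paw-triangle-vertex-only-in-M
      (C∩M≡∅ x x∈C) v∈M (C∩M≡∅ y y∈C) (C∩M≡∅ z z∈C)
      (Adj-sym G vx , vy , xy , Adj-sym G xz , ¬Adj-sym G ¬vz ,
       λ zy → triangle-free x y z x∈C y∈C z∈C (xy , Adj-sym G zy , xz)))

    SeesEdgeAt⇒Adj : ∀ {x} → SeesEdgeAt x → Adj G v x
    SeesEdgeAt⇒Adj (_ , _ , _ , vx , _) = vx

    edgesDominate-of-dominating : (∀ x → x ∈ C → Adj G v x) → EdgesDominateIn G C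
    edgesDominate-of-dominating v-dom {a} {b} {z} a∈C b∈C z∈C ab ¬za ¬zb =
      ¬Paw-centre-only-in-M v∈M (C∩M≡∅ a a∈C) (C∩M≡∅ b b∈C) (C∩M≡∅ z z∈C)
        (v-dom a a∈C , ab , v-dom b b∈C , Adj-sym G (v-dom z z∈C) , ¬za , ¬zb)

proposition6 : ∀ {n} (G : Graph n) (M C : Subset n) →
    IsModulator G M → IsComponentMinus G M C → TriangleFreeIn G C →
    (v u w : Fin n) → v ∈ M → u ∈ C → w ∈ C →
    Adj G u w → Adj G v u → Adj G v w →
    (∀ x → x ∈ C → Adj G v x) × CompleteBipartiteIn G C
proposition6 G M C modulator (_ , C∩M≡∅ , connected , _) triangle-free v u w v∈M u∈C w∈C
             uw vu vw = v-dominates , bipartite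
  where
  open ApexInM G modulator C∩M≡∅ triangle-free v∈M

  v-dominates : ∀ x → x ∈ C → Adj G v x
  v-dominates x x∈C = SeesEdgeAt⇒Adj (WalkIn-transport G SeesEdgeAt SeesEdgeAt-step
    (connected u x u∈C x∈C) (w , w∈C , uw , vu , vw))

  bipartite : CompleteBipartiteIn G C
  bipartite = completeBipartite-of-edgesDominate G triangle-free
    (edgesDominate-of-dominating v-dominates) u∈C w∈C uw
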